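{- Let $\mathbb G$ and $\mathbb H$ be finite loopless graphs that are not 3-colorable, let $e=(u,v)$ be a critical edge of $\mathbb G$ and $f=(u',v')$ a critical edge of $\mathbb H$, and let $\mathbb W=(\mathbb G,e)\oplus(\mathbb H,f)$. Then: (1) $\mathbb W$ is not 3-colorable; (2) the edge $d$ (of the copy of $\mathbb N$ in $\mathbb W$) is a critical edge of $\mathbb W$; (3) $\Sigma_{\mathbb W}$ is implied by $\Sigma_{\mathbb G}$ and also by $\Sigma_{\mathbb H}$.
   Context: Graphs are undirected (one symmetric binary relation); 3-colorable means having a homomorphism to $\mathbb K_3$, the complete loopless graph on 3 vertices. An edge $e$ of $\mathbb M$ is critical if the graph $\mathbb M-e$ obtained by removing $e$ is 3-colorable. The gadget graph $\mathbb N$ has vertices $t_0,\dots,t_5$, $b_0,\dots,b_5$, $c_0,c_1,c_3,c_4$, $p$, $q$ and edges: $t_it_{i+1}$ and $b_ib_{i+1}$ for $0\le i\le 4$; for each $i\in\{0,1,3,4\}$, $c_i$ adjacent to $t_i,t_{i+1},b_i,b_{i+1}$; $b_2t_3$ and $b_3t_2$; $p$ adjacent to $b_2,b_3$; $q$ adjacent to $t_2,t_3$; and the edge $d=pq$. Set $x=t_0$, $x'=b_0$, $y=t_5$, $y'=b_5$. The graph $(\mathbb G,e)\oplus(\mathbb H,f)$ is obtained from the disjoint union of $\mathbb G-e$, $\mathbb H-f$ and $\mathbb N$ by identifying $u$ with $x$, $v$ with $x'$, $u'$ with $y$, and $v'$ with $y'$ (so $(x,x')$ and $(y,y')$ are non-edges).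 For a finite graph $\mathbb G=(V,E)$, the height 1 condition $\Sigma_{\mathbb G}$ has a ternary symbol $f_w$ for each $w\in V$ and a 6-ary symbol $g_{(w,z)}$ for each $(w,z)\in E$ with identities $f_w(x,y,z)\approx g_{(w,z)}(x,y,x,z,y,z)$ and $f_z(x,y,z)\approx g_{(w,z)}(y,x,z,x,z,y)$. A clone (set of finitary operations containing projections and closed under composition) satisfies a height 1 condition if its symbols can be interpreted in it with matching arities making the identities true; $\Sigma$ implies $\Sigma'$ if every clone satisfying $\Sigma$ satisfies $\Sigma'$. -}

module Defs where

open import Level using (Level; _⊔_) renaming (suc to lsuc; zero to lzero)
open import Data.Nat using (ℕ)
open import Data.Fin using (Fin)
open import Data.Product using (Σ; _×_; _,_; ∃)
open import Data.Sum using (_⊎_; inj₁; inj₂)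
open import Data.Vec.Functional using ([]; _∷_)
open import Relation.Nullary using (¬_)
open import Relation.Binary.PropositionalEquality using (_≡_; _≢_; refl)
open import Function.Bundles using (_↔_)

record Graph : Set₁ where
  field
    V   : Set
    E   : V → V → Set
    sym : ∀ {a b} → E a b → E b a
open Graph public

Finite : Graph → Set
Finite M = ∃ λ n → V M ↔ Fin n

Loopless : Graph → Set
Loopless M = ∀ a → ¬ E M a a

ThreeColorable : Graph → Set
ThreeColorable M = Σ (V M → Fin 3) λ c → ∀ {a b} → E M a b → c a ≢ c b

_─_ : (M : Graph) → V M × V M → Graph
M ─ (u , v) = record
  { V = V M
  ; E = λ a b → E M a b × ¬ ((a ≡ u × b ≡ v) ⊎ (a ≡ v × b ≡ u))
  ; sym = λ { (e , ne) → sym M e , λ { (inj₁ (p , q)) → ne (inj₂ (q , p))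
                                      ; (inj₂ (p , q)) → ne (inj₁ (q , p)) } }
  }

Critical : (M : Graph) → V M → V M → Set
Critical M u v = E M u v × ThreeColorable (M ─ (u , v))

-- the 14 vertices of N other than x = t0, x' = b0, y = t5, y' = b5
data Inner : Set where
  t1 t2 t3 t4 b1 b2 b3 b4 c0 c1 c3 c4 p q : Inner

data NV : Set where
  x x' y y' : NV
  inn : Inner → NV

-- one orientation of each edge of N
data NE₀ : NV → NV → Set where
  tt0 : NE₀ x (inn t1)
  tt1 : NE₀ (inn t1) (inn t2)
  tt2 : NE₀ (inn t2) (inn t3)
  tt3 : NE₀ (inn t3) (inn t4)
  tt4 : NE₀ (inn t4) y
  bb0 : NE₀ x' (inn b1)
  bb1 : NE₀ (inn b1) (inn b2)
  bb2 : NE₀ (inn b2) (inn b3)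
  bb3 : NE₀ (inn b3) (inn b4)
  bb4 : NE₀ (inn b4) y'
  c0t0 : NE₀ (inn c0) x
  c0t1 : NE₀ (inn c0) (inn t1)
  c0b0 : NE₀ (inn c0) x'
  c0b1 : NE₀ (inn c0) (inn b1)
  c1t1 : NE₀ (inn c1) (inn t1)
  c1t2 : NE₀ (inn c1) (inn t2)
  c1b1 : NE₀ (inn c1) (inn b1)
  c1b2 : NE₀ (inn c1) (inn b2)
  c3t3 : NE₀ (inn c3) (inn t3)
  c3t4 : NE₀ (inn c3) (inn t4)
  c3b3 : NE₀ (inn c3) (inn b3)
  c3b4 : NE₀ (inn c3) (inn b4)
  c4t4 : NE₀ (inn c4) (inn t4)
  c4t5 : NE₀ (inn c4) y
  c4b4 : NE₀ (inn c4) (inn b4)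
  c4b5 : NE₀ (inn c4) y'
  b2t3 : NE₀ (inn b2) (inn t3)
  b3t2 : NE₀ (inn b3) (inn t2)
  pb2 : NE₀ (inn p) (inn b2)
  pb3 : NE₀ (inn p) (inn b3)
  qt2 : NE₀ (inn q) (inn t2)
  qt3 : NE₀ (inn q) (inn t3)
  -- the edge d = pq
  pq : NE₀ (inn p) (inn q)

NE : NV → NV → Set
NE a b = NE₀ a b ⊎ NE₀ b a

module Oplus (G : Graph) (u v : V G) (H : Graph) (u' v' : V H) where

  WV : Set
  WV = V G ⊎ (V H ⊎ Inner)

  ι : NV → WV
  ι x = inj₁ u
  ι x' = inj₁ v
  ι y = inj₂ (inj₁ u')
  ι y' = inj₂ (inj₁ v')
  ι (inn i) = inj₂ (inj₂ i)

  data WE : WV → WV → Set where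
    gE : ∀ {a b} → E (G ─ (u , v)) a b → WE (inj₁ a) (inj₁ b)
    hE : ∀ {a b} → E (H ─ (u' , v')) a b → WE (inj₂ (inj₁ a)) (inj₂ (inj₁ b))
    nE : ∀ {a b} (m n : NV) → NE m n → ι m ≡ a → ι n ≡ b → WE a b

  WE-sym : ∀ {a b} → WE a b → WE b a
  WE-sym (gE e) = gE (sym (G ─ (u , v)) e)
  WE-sym (hE e) = hE (sym (H ─ (u' , v')) e)
  WE-sym (nE m n (inj₁ e) p₁ p₂) = nE n m (inj₂ e) p₂ p₁
  WE-sym (nE m n (inj₂ e) p₁ p₂) = nE n m (inj₁ e) p₂ p₁

  W : Graph
  W = record { V = WV ; E = WE ; sym = WE-sym }

  dp dq : WV
  dp = ι (inn p)
  dq = ι (inn q)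

_⊕_ : (Σ Graph λ M → V M × V M) → (Σ Graph λ M → V M × V M) → Graph
(G , u , v) ⊕ (H , u' , v') = Oplus.W G u v H u' v'

Op : ∀ {a} → Set a → ℕ → Set a
Op A n = (Fin n → A) → A

record Clone {a} (A : Set a) (ℓ : Level) : Set (a ⊔ lsuc ℓ) where
  field
    _∈C : ∀ {n} → Op A n → Set ℓ
    proj : ∀ {n} (i : Fin n) → (λ (xs : Fin n → A) → xs i) ∈C
    comp : ∀ {n m} {f : Op A n} {gs : Fin n → Op A m} →
           f ∈C → (∀ i → gs i ∈C) → (λ xs → f (λ i → gs i xs)) ∈C
    -- clones are sets of functions: membership is extensional
    ext : ∀ {n} {f g : Op A n} → f ∈C → (∀ xs → f xs ≡ g xs) → g ∈C
open Clone public

Satisfies : ∀ {a ℓ} {A : Set a} → Clone A ℓ → Graph → Set (a ⊔ ℓ)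
Satisfies {A = A} C M =
  Σ (V M → Op A 3) λ f →
  Σ (∀ w z → E M w z → Op A 6) λ g →
    (∀ w → _∈C C (f w)) ×
    (∀ w z (e : E M w z) → _∈C C (g w z e)) ×
    (∀ w z (e : E M w z) (a b c : A) →
        (f w (a ∷ b ∷ c ∷ []) ≡ g w z e (a ∷ b ∷ a ∷ c ∷ b ∷ c ∷ [])) ×
        (f z (a ∷ b ∷ c ∷ []) ≡ g w z e (b ∷ a ∷ c ∷ a ∷ c ∷ b ∷ [])))

Implies : (a ℓ : Level) → Graph → Graph → Set (lsuc a ⊔ lsuc ℓ)
Implies a ℓ M M' = (A : Set a) (C : Clone A ℓ) → Satisfies C M → Satisfies C M'

-- With three colours, a colour
-- avoiding two distinct colours is determined (`avoid-same`); propagated through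
-- the blocks of N this shows that no 3-colouring of N gives x, x' one colour and
-- y, y' one colour (`ends-apart`), which yields (1).  Conversely N − d has such
-- colourings (`parallel`), which yields (2), and N has colourings with x, x'
-- distinct and y, y' equal (`crossing`).  N is left-right symmetric (`mirror`).
--
-- For (3), Σ_M holds in a clone C iff the vertices of M can be sent to ternary
-- members of C so that adjacent vertices are `Linked`: both are minors of one
-- 6-ary member along the tails and heads of the six arcs of K₃.  Minors of a fixed
-- operation along coordinatewise distinct colour tuples are linked
-- (`minor-linked`), so labelling the vertices of W outside G − e by 6-tuples of
-- colours, coordinatewise properly, extends an interpretation of Σ_G to Σ_W.
-- The case of H follows along the homomorphism `exchange` from W to (H,f) ⊕ (G,e).
module Submission where

open import Defs
open import Level using (Level; _⊔_)
open import Data.Nat using (zero; suc)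
open import Data.Fin using (Fin; zero; suc)
open import Data.Fin.Patterns using (0F; 1F; 2F; 3F; 4F; 5F)
open import Data.Fin.Properties using (_≟_)
open import Data.Product using (Σ; _×_; _,_; proj₁; proj₂)
open import Data.Sum using (_⊎_; inj₁; inj₂; swap)
open import Data.Vec.Functional using ([]; _∷_)
open import Data.Empty using (⊥; ⊥-elim)
open import Function using (_∘_)
open import Relation.Nullary using (¬_; yes; no)
open import Relation.Binary.PropositionalEquality as ≡ using (_≡_; _≢_; refl; trans; cong; cong₂; ≢-sym)

other : Fin 3 → Fin 3 → Fin 3
other 0F 0F = 1F
other 0F 1F = 2F
other 0F 2F = 1F
other 1F 0F = 2F
other 1F 1F = 0F
other 1F 2F = 0F
other 2F 0F = 1F
other 2F 1F = 0F
other 2F 2F = 0F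

other-≢ˡ : ∀ a b → other a b ≢ a
other-≢ˡ 0F 0F ()
other-≢ˡ 0F 1F ()
other-≢ˡ 0F 2F ()
other-≢ˡ 1F 0F ()
other-≢ˡ 1F 1F ()
other-≢ˡ 1F 2F ()
other-≢ˡ 2F 0F ()
other-≢ˡ 2F 1F ()
other-≢ˡ 2F 2F ()

other-≢ʳ : ∀ a b → other a b ≢ b
other-≢ʳ 0F 0F ()
other-≢ʳ 0F 1F ()
other-≢ʳ 0F 2F ()
other-≢ʳ 1F 0F ()
other-≢ʳ 1F 1F ()
other-≢ʳ 1F 2F ()
other-≢ʳ 2F 0F ()
other-≢ʳ 2F 1F ()
other-≢ʳ 2F 2F ()

other-unique : ∀ {a b c} → a ≢ b → c ≢ a → c ≢ b → c ≡ other a b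
other-unique {0F} {0F} a≢b _ _ = ⊥-elim (a≢b refl)
other-unique {1F} {1F} a≢b _ _ = ⊥-elim (a≢b refl)
other-unique {2F} {2F} a≢b _ _ = ⊥-elim (a≢b refl)
other-unique {0F} {1F} {0F} _ c≢a _ = ⊥-elim (c≢a refl)
other-unique {0F} {1F} {1F} _ _ c≢b = ⊥-elim (c≢b refl)
other-unique {0F} {1F} {2F} _ _ _ = refl
other-unique {0F} {2F} {0F} _ c≢a _ = ⊥-elim (c≢a refl)
other-unique {0F} {2F} {1F} _ _ _ = refl
other-unique {0F} {2F} {2F} _ _ c≢b = ⊥-elim (c≢b refl)
other-unique {1F} {0F} {0F} _ _ c≢b = ⊥-elim (c≢b refl)
other-unique {1F} {0F} {1F} _ c≢a _ = ⊥-elim (c≢a refl)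
other-unique {1F} {0F} {2F} _ _ _ = refl
other-unique {1F} {2F} {0F} _ _ _ = refl
other-unique {1F} {2F} {1F} _ c≢a _ = ⊥-elim (c≢a refl)
other-unique {1F} {2F} {2F} _ _ c≢b = ⊥-elim (c≢b refl)
other-unique {2F} {0F} {0F} _ _ c≢b = ⊥-elim (c≢b refl)
other-unique {2F} {0F} {1F} _ _ _ = refl
other-unique {2F} {0F} {2F} _ c≢a _ = ⊥-elim (c≢a refl)
other-unique {2F} {1F} {0F} _ _ _ = refl
other-unique {2F} {1F} {1F} _ _ c≢b = ⊥-elim (c≢b refl)
other-unique {2F} {1F} {2F} _ c≢a _ = ⊥-elim (c≢a refl)

avoid-same : ∀ {a b c d} → a ≢ b → c ≢ a → c ≢ b → d ≢ a → d ≢ b → c ≡ d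
avoid-same a≢b c≢a c≢b d≢a d≢b =
  trans (other-unique a≢b c≢a c≢b) (≡.sym (other-unique a≢b d≢a d≢b))

Proper : (M : Graph) → (V M → Fin 3) → Set
Proper M c = ∀ {a b} → E M a b → c a ≢ c b

Pinned : (M : Graph) → V M → V M → Set
Pinned M u v = Σ (V M → Fin 3) λ c → Proper (M ─ (u , v)) c × c u ≡ c v

-- If M is not 3-colourable, every 3-colouring of M − (u,v) gives u and v the
-- same colour: otherwise it would also colour the edge (u,v) properly.
ends-agree : (M : Graph) (u v : V M) → ¬ ThreeColorable M →
             (c : V M → Fin 3) → Proper (M ─ (u , v)) c → c u ≡ c v
ends-agree M u v not-col c ok with c u ≟ c v
... | yes u~v = u~v
... | no u≁v = ⊥-elim (not-col (c , λ e same → ok (e , not-uv same) same))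
  where
  not-uv : ∀ {a b} → c a ≡ c b → ¬ ((a ≡ u × b ≡ v) ⊎ (a ≡ v × b ≡ u))
  not-uv same (inj₁ (refl , refl)) = u≁v same
  not-uv same (inj₂ (refl , refl)) = u≁v (≡.sym same)

pinned : (M : Graph) (u v : V M) → ¬ ThreeColorable M →
         ThreeColorable (M ─ (u , v)) → Pinned M u v
pinned M u v not-col (c , ok) = c , ok , ends-agree M u v not-col c ok

_⟶_ : Graph → Graph → Set
M ⟶ M' = Σ (V M → V M') λ h → ∀ {a b} → E M a b → E M' (h a) (h b)

ProperN : (NV → Fin 3) → Set
ProperN γ = ∀ {m n} → NE₀ m n → γ m ≢ γ n

ProperN⁻ : (NV → Fin 3) → Set
ProperN⁻ γ = ∀ {m n} → NE₀ m n → ¬ (m ≡ inn p × n ≡ inn q) → γ m ≢ γ n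

proper-both-ways : ∀ {γ} → ProperN γ → ∀ {m n} → NE m n → γ m ≢ γ n
proper-both-ways ok (inj₁ e) = ok e
proper-both-ways ok (inj₂ e) = ≢-sym (ok e)

-- In each block
-- c_i the triangles t_i c_i t_{i+1} and b_i c_i b_{i+1} pass the equality t_i = b_i
-- on to t_{i+1} = b_{i+1}; from both ends this reaches t₂ = b₂ and t₃ = b₃, and
-- then p and q both avoid the distinct colours of t₂ and t₃, so p = q.
ends-apart : (γ : NV → Fin 3) → ProperN γ → γ x ≡ γ x' → γ y ≡ γ y' → ⊥
ends-apart γ ok x~x' y~y' = ok pq (avoid-same (ok tt2) p≢t2 p≢t3 (ok qt2) (ok qt3))
  where
  ok± : ∀ {m n} → NE m n → γ m ≢ γ n
  ok± = proper-both-ways ok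

  pass : ∀ {t b t' b' c} → NE t t' → NE b b' → NE c t → NE c t' → NE c b' →
         γ t ≡ γ b → γ t' ≡ γ b'
  pass tt' bb' ct ct' cb' t~b =
    avoid-same (≢-sym (ok± ct)) (≢-sym (ok± tt')) (≢-sym (ok± ct'))
               (λ b'~t → ok± bb' (≡.sym (trans b'~t t~b))) (≢-sym (ok± cb'))

  t1~b1 : γ (inn t1) ≡ γ (inn b1)
  t1~b1 = pass (inj₁ tt0) (inj₁ bb0) (inj₁ c0t0) (inj₁ c0t1) (inj₁ c0b1) x~x'
  t2~b2 : γ (inn t2) ≡ γ (inn b2)
  t2~b2 = pass (inj₁ tt1) (inj₁ bb1) (inj₁ c1t1) (inj₁ c1t2) (inj₁ c1b2) t1~b1
  t4~b4 : γ (inn t4) ≡ γ (inn b4)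
  t4~b4 = pass (inj₂ tt4) (inj₂ bb4) (inj₁ c4t5) (inj₁ c4t4) (inj₁ c4b4) y~y'
  t3~b3 : γ (inn t3) ≡ γ (inn b3)
  t3~b3 = pass (inj₂ tt3) (inj₂ bb3) (inj₁ c3t4) (inj₁ c3t3) (inj₁ c3b3) t4~b4

  p≢t2 : γ (inn p) ≢ γ (inn t2)
  p≢t2 p~t2 = ok pb2 (trans p~t2 t2~b2)
  p≢t3 : γ (inn p) ≢ γ (inn t3)
  p≢t3 p~t3 = ok pb3 (trans p~t3 t3~b3)

-- The top and
-- bottom rows swap α and α' in the left blocks, meet in γ = other α α' at t₃ = b₃,
-- and reach β through δ = other γ β; p and q take α and α'.
crossing : Fin 3 → Fin 3 → Fin 3 → NV → Fin 3
crossing α α' β = colour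
  where
  γ δ : Fin 3
  γ = other α α'
  δ = other γ β

  colour : NV → Fin 3
  colour x = α
  colour x' = α'
  colour y = β
  colour y' = β
  colour (inn t1) = α'
  colour (inn b1) = α
  colour (inn t2) = α
  colour (inn b2) = α'
  colour (inn t3) = γ
  colour (inn b3) = γ
  colour (inn t4) = δ
  colour (inn b4) = δ
  colour (inn c0) = γ
  colour (inn c1) = γ
  colour (inn c3) = other γ δ
  colour (inn c4) = other δ β
  colour (inn p) = α
  colour (inn q) = α'

crossing-proper : ∀ {α α'} β → α ≢ α' → ProperN (crossing α α' β)
crossing-proper {α} {α'} β α≢α' = λ where
    tt0 → α≢α'
    tt1 → ≢-sym α≢α'
    tt2 → ≢-sym γ≢α
    tt3 → ≢-sym δ≢γ
    tt4 → δ≢β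
    bb0 → ≢-sym α≢α'
    bb1 → α≢α'
    bb2 → ≢-sym γ≢α'
    bb3 → ≢-sym δ≢γ
    bb4 → δ≢β
    c0t0 → γ≢α
    c0t1 → γ≢α'
    c0b0 → γ≢α'
    c0b1 → γ≢α
    c1t1 → γ≢α'
    c1t2 → γ≢α
    c1b1 → γ≢α
    c1b2 → γ≢α'
    c3t3 → other-≢ˡ γ δ
    c3t4 → other-≢ʳ γ δ
    c3b3 → other-≢ˡ γ δ
    c3b4 → other-≢ʳ γ δ
    c4t4 → other-≢ˡ δ β
    c4t5 → other-≢ʳ δ β
    c4b4 → other-≢ˡ δ β
    c4b5 → other-≢ʳ δ β
    b2t3 → ≢-sym γ≢α'
    b3t2 → γ≢α
    pb2 → α≢α'
    pb3 → ≢-sym γ≢α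
    qt2 → ≢-sym α≢α'
    qt3 → ≢-sym γ≢α'
    pq → α≢α'
  where
  γ δ : Fin 3
  γ = other α α'
  δ = other γ β
  γ≢α : γ ≢ α
  γ≢α = other-≢ˡ α α'
  γ≢α' : γ ≢ α'
  γ≢α' = other-≢ʳ α α'
  δ≢γ : δ ≢ γ
  δ≢γ = other-≢ˡ γ β
  δ≢β : δ ≢ β
  δ≢β = other-≢ʳ γ β

-- Both rows carry the same
-- colours α, τ, α, τ, ε, β with τ = other α β and ε = other τ β; each c_i avoids
-- the two colours of its block, and p, q share the colour avoiding α and τ.
parallel : Fin 3 → Fin 3 → NV → Fin 3
parallel α β = colour
  where
  τ ε κ : Fin 3
  τ = other α β
  ε = other τ β
  κ = other α τ

  colour : NV → Fin 3
  colour x = α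
  colour x' = α
  colour y = β
  colour y' = β
  colour (inn t1) = τ
  colour (inn b1) = τ
  colour (inn t2) = α
  colour (inn b2) = α
  colour (inn t3) = τ
  colour (inn b3) = τ
  colour (inn t4) = ε
  colour (inn b4) = ε
  colour (inn c0) = κ
  colour (inn c1) = κ
  colour (inn c3) = other τ ε
  colour (inn c4) = other ε β
  colour (inn p) = κ
  colour (inn q) = κ

parallel-proper : ∀ α β → ProperN⁻ (parallel α β)
parallel-proper α β = λ where
    tt0 _ → ≢-sym τ≢α
    tt1 _ → τ≢α
    tt2 _ → ≢-sym τ≢α
    tt3 _ → ≢-sym ε≢τ
    tt4 _ → ε≢β
    bb0 _ → ≢-sym τ≢α
    bb1 _ → τ≢α
    bb2 _ → ≢-sym τ≢α
    bb3 _ → ≢-sym ε≢τ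
    bb4 _ → ε≢β
    c0t0 _ → κ≢α
    c0t1 _ → κ≢τ
    c0b0 _ → κ≢α
    c0b1 _ → κ≢τ
    c1t1 _ → κ≢τ
    c1t2 _ → κ≢α
    c1b1 _ → κ≢τ
    c1b2 _ → κ≢α
    c3t3 _ → other-≢ˡ τ ε
    c3t4 _ → other-≢ʳ τ ε
    c3b3 _ → other-≢ˡ τ ε
    c3b4 _ → other-≢ʳ τ ε
    c4t4 _ → other-≢ˡ ε β
    c4t5 _ → other-≢ʳ ε β
    c4b4 _ → other-≢ˡ ε β
    c4b5 _ → other-≢ʳ ε β
    b2t3 _ → ≢-sym τ≢α
    b3t2 _ → τ≢α
    pb2 _ → κ≢α
    pb3 _ → κ≢τ
    qt2 _ → κ≢α
    qt3 _ → κ≢τ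
    pq not-d → ⊥-elim (not-d (refl , refl))
  where
  τ ε κ : Fin 3
  τ = other α β
  ε = other τ β
  κ = other α τ
  τ≢α : τ ≢ α
  τ≢α = other-≢ˡ α β
  ε≢τ : ε ≢ τ
  ε≢τ = other-≢ˡ τ β
  ε≢β : ε ≢ β
  ε≢β = other-≢ʳ τ β
  κ≢α : κ ≢ α
  κ≢α = other-≢ˡ α τ
  κ≢τ : κ ≢ τ
  κ≢τ = other-≢ʳ α τ

mirror : NV → NV
mirror x = y
mirror x' = y'
mirror y = x
mirror y' = x'
mirror (inn t1) = inn t4
mirror (inn t2) = inn t3
mirror (inn t3) = inn t2
mirror (inn t4) = inn t1
mirror (inn b1) = inn b4
mirror (inn b2) = inn b3
mirror (inn b3) = inn b2
mirror (inn b4) = inn b1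
mirror (inn c0) = inn c4
mirror (inn c1) = inn c3
mirror (inn c3) = inn c1
mirror (inn c4) = inn c0
mirror (inn p) = inn p
mirror (inn q) = inn q

mirror-edge₀ : ∀ {m n} → NE₀ m n → NE (mirror m) (mirror n)
mirror-edge₀ tt0 = inj₂ tt4
mirror-edge₀ tt1 = inj₂ tt3
mirror-edge₀ tt2 = inj₂ tt2
mirror-edge₀ tt3 = inj₂ tt1
mirror-edge₀ tt4 = inj₂ tt0
mirror-edge₀ bb0 = inj₂ bb4
mirror-edge₀ bb1 = inj₂ bb3
mirror-edge₀ bb2 = inj₂ bb2
mirror-edge₀ bb3 = inj₂ bb1
mirror-edge₀ bb4 = inj₂ bb0
mirror-edge₀ c0t0 = inj₁ c4t5
mirror-edge₀ c0t1 = inj₁ c4t4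
mirror-edge₀ c0b0 = inj₁ c4b5
mirror-edge₀ c0b1 = inj₁ c4b4
mirror-edge₀ c1t1 = inj₁ c3t4
mirror-edge₀ c1t2 = inj₁ c3t3
mirror-edge₀ c1b1 = inj₁ c3b4
mirror-edge₀ c1b2 = inj₁ c3b3
mirror-edge₀ c3t3 = inj₁ c1t2
mirror-edge₀ c3t4 = inj₁ c1t1
mirror-edge₀ c3b3 = inj₁ c1b2
mirror-edge₀ c3b4 = inj₁ c1b1
mirror-edge₀ c4t4 = inj₁ c0t1
mirror-edge₀ c4t5 = inj₁ c0t0
mirror-edge₀ c4b4 = inj₁ c0b1
mirror-edge₀ c4b5 = inj₁ c0b0
mirror-edge₀ b2t3 = inj₁ b3t2
mirror-edge₀ b3t2 = inj₁ b2t3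
mirror-edge₀ pb2 = inj₁ pb3
mirror-edge₀ pb3 = inj₁ pb2
mirror-edge₀ qt2 = inj₁ qt3
mirror-edge₀ qt3 = inj₁ qt2
mirror-edge₀ pq = inj₁ pq

mirror-edge : ∀ {m n} → NE m n → NE (mirror m) (mirror n)
mirror-edge (inj₁ e) = mirror-edge₀ e
mirror-edge (inj₂ e) = swap (mirror-edge₀ e)

module _ {a} {A : Set a} where

  -- The eta-expansion of a tuple.  On a tuple of literal length it computes to an
  -- explicit vector, so minors below evaluate to the argument lists of Σ_M.
  expand : ∀ {n} → (Fin n → A) → Fin n → A
  expand {zero} xs = []
  expand {suc n} xs = xs zero ∷ expand (xs ∘ suc)

  expand-correct : ∀ {n} (xs : Fin n → A) i → expand xs i ≡ xs i
  expand-correct xs zero = refl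
  expand-correct xs (suc i) = expand-correct (xs ∘ suc) i

  expand-cong : ∀ {n} {xs ys : Fin n → A} → (∀ i → xs i ≡ ys i) → expand xs ≡ expand ys
  expand-cong {zero} _ = refl
  expand-cong {suc n} xs≗ys = cong₂ _∷_ (xs≗ys zero) (expand-cong (xs≗ys ∘ suc))

  minor : ∀ {n m} → Op A n → (Fin n → Fin m) → Op A m
  minor g ρ xs = g (expand (xs ∘ ρ))

  minor-cong : ∀ {n m} (g : Op A n) {ρ ρ' : Fin n → Fin m} →
               (∀ i → ρ i ≡ ρ' i) → ∀ xs → minor g ρ xs ≡ minor g ρ' xs
  minor-cong g ρ≗ρ' xs = cong g (expand-cong (cong xs ∘ ρ≗ρ'))

  minor-minor : ∀ {n m k} (g : Op A n) (ρ : Fin n → Fin m) (π : Fin m → Fin k) →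
                ∀ xs → minor (minor g ρ) π xs ≡ minor g (π ∘ ρ) xs
  minor-minor g ρ π xs = cong g (expand-cong (expand-correct (xs ∘ π) ∘ ρ))

  minor-∈ : ∀ {ℓ} (C : Clone A ℓ) {n m} {g : Op A n} → _∈C C g →
            (ρ : Fin n → Fin m) → _∈C C (minor g ρ)
  minor-∈ C g∈ ρ = comp C g∈ λ i →
    ext C (proj C (ρ i)) (λ xs → ≡.sym (expand-correct (xs ∘ ρ) i))

-- Tails and heads of the arcs of K₃, listed so that the arguments (a,b,a,c,b,c)
-- and (b,a,c,a,c,b) of g_(w,z) in Σ_M are the tuple (a,b,c) read along tails
-- and along heads.
tail head : Fin 6 → Fin 3
tail = 0F ∷ 1F ∷ 0F ∷ 2F ∷ 1F ∷ 2F ∷ []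
head = 1F ∷ 0F ∷ 2F ∷ 0F ∷ 2F ∷ 1F ∷ []

tail≢head : ∀ j → tail j ≢ head j
tail≢head 0F ()
tail≢head 1F ()
tail≢head 2F ()
tail≢head 3F ()
tail≢head 4F ()
tail≢head 5F ()

-- The position of the arc (k,l) in the list (irrelevant for loops k = l).
arc : Fin 3 → Fin 3 → Fin 6
arc 0F 1F = 0F
arc 1F 0F = 1F
arc 0F 2F = 2F
arc 2F 0F = 3F
arc 1F 2F = 4F
arc 2F 1F = 5F
arc _ _ = 0F

arc-ends : ∀ {k l} → k ≢ l → tail (arc k l) ≡ k × head (arc k l) ≡ l
arc-ends {0F} {0F} k≢l = ⊥-elim (k≢l refl)
arc-ends {0F} {1F} _ = refl , refl
arc-ends {0F} {2F} _ = refl , refl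
arc-ends {1F} {0F} _ = refl , refl
arc-ends {1F} {1F} k≢l = ⊥-elim (k≢l refl)
arc-ends {1F} {2F} _ = refl , refl
arc-ends {2F} {0F} _ = refl , refl
arc-ends {2F} {1F} _ = refl , refl
arc-ends {2F} {2F} k≢l = ⊥-elim (k≢l refl)

module Linking {a ℓ} {A : Set a} (C : Clone A ℓ) where

  _≈₃_ : Op A 3 → Op A 3 → Set a
  f ≈₃ f' = ∀ a b c → f (a ∷ b ∷ c ∷ []) ≡ f' (a ∷ b ∷ c ∷ [])

  -- f₁ and f₂ can interpret the two ends of an edge of Σ_M: they are the minors
  -- of one 6-ary op ∈ C along the tails and the heads of the arcs of K₃.
  record Linked (f₁ f₂ : Op A 3) : Set (a ⊔ ℓ) where
    constructor linking
    field
      op : Op A 6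
      op∈ : _∈C C op
      at-tails : f₁ ≈₃ minor op tail
      at-heads : f₂ ≈₃ minor op head
  open Linked

  Linked-resp : ∀ {f₁ f₁' f₂ f₂'} → f₁ ≈₃ f₁' → f₂ ≈₃ f₂' → Linked f₁' f₂' → Linked f₁ f₂
  Linked-resp f₁≈ f₂≈ (linking g g∈ f₁'≈ f₂'≈) =
    linking g g∈ (λ a b c → trans (f₁≈ a b c) (f₁'≈ a b c))
                 (λ a b c → trans (f₂≈ a b c) (f₂'≈ a b c))

  satisfies : (M : Graph) (F : V M → Op A 3) → (∀ w → _∈C C (F w)) →
              (∀ {w z} → E M w z → Linked (F w) (F z)) → Satisfies C M
  satisfies M F F∈ link =
    F , (λ _ _ e → op (link e)) , F∈ , (λ _ _ e → op∈ (link e)) ,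
    λ _ _ e a b c → at-tails (link e) a b c , at-heads (link e) a b c

  linked : (M : Graph) (s : Satisfies C M) → ∀ {w z} → E M w z → Linked (proj₁ s w) (proj₁ s z)
  linked M (_ , g , _ , g∈ , ids) {w} {z} e =
    linking (g w z e) (g∈ w z e) (λ a b c → proj₁ (ids w z e a b c))
                                 (λ a b c → proj₂ (ids w z e a b c))

  -- Minors of one g ∈ C along two coordinatewise distinct colour tuples are
  -- linked: read both through the minor of g along the arcs (τ j, σ j).
  minor-linked : ∀ {g} → _∈C C g → (τ σ : Fin 6 → Fin 3) → (∀ j → τ j ≢ σ j) →
                 Linked (minor g τ) (minor g σ)
  minor-linked {g} g∈ τ σ τ≢σ =
    linking (minor g ρ) (minor-∈ C g∈ ρ) (reads tail tails) (reads head heads)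
    where
    ρ : Fin 6 → Fin 6
    ρ j = arc (τ j) (σ j)

    tails : ∀ j → τ j ≡ tail (ρ j)
    tails j = ≡.sym (proj₁ (arc-ends (τ≢σ j)))
    heads : ∀ j → σ j ≡ head (ρ j)
    heads j = ≡.sym (proj₂ (arc-ends (τ≢σ j)))

    reads : ∀ {κ} (π : Fin 6 → Fin 3) → (∀ j → κ j ≡ π (ρ j)) → minor g κ ≈₃ minor (minor g ρ) π
    reads π κ≗πρ a b c = trans (minor-cong g κ≗πρ xs) (≡.sym (minor-minor g ρ π xs))
      where xs = a ∷ b ∷ c ∷ []

  satisfies-pullback : (M M' : Graph) → M ⟶ M' → Satisfies C M' → Satisfies C M
  satisfies-pullback M M' (h , h-edge) s =
    satisfies M (proj₁ s ∘ h) (proj₁ (proj₂ (proj₂ s)) ∘ h) (λ e → linked M' s (h-edge e))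

module Glued (G : Graph) (u v : V G) (H : Graph) (u' v' : V H) where
  open Oplus G u v H u' v'

  -- (1) A colouring of W restricts to colourings of G − e and H − f, which give
  -- x, x' and y, y' equal colours when G and H are not 3-colourable; its
  -- restriction to N then contradicts `ends-apart`.
  not-colourable : ¬ ThreeColorable G → ¬ ThreeColorable H → ¬ ThreeColorable W
  not-colourable not-G not-H (c , ok) =
    ends-apart (c ∘ ι) (λ e → ok (nE _ _ (inj₁ e) refl refl))
      (ends-agree G u v not-G (c ∘ inj₁) (λ e → ok (gE e)))
      (ends-agree H u' v' not-H (c ∘ inj₂ ∘ inj₁) (λ e → ok (hE e)))

  -- (2) d is critical: colour G − e and H − f by pinned colourings and the rest
  -- of N − d by `parallel`, which agrees with them on x, x', y, y'.
  d-critical : Pinned G u v → Pinned H u' v' → Critical W dp dq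
  d-critical (cG , okG , u~v) (cH , okH , u'~v') =
    nE (inn p) (inn q) (inj₁ pq) refl refl , colour , proper
    where
    γ : NV → Fin 3
    γ = parallel (cG u) (cH u')

    colour : WV → Fin 3
    colour (inj₁ w) = cG w
    colour (inj₂ (inj₁ w)) = cH w
    colour (inj₂ (inj₂ i)) = γ (inn i)

    on-N : ∀ m → colour (ι m) ≡ γ m
    on-N x = refl
    on-N x' = ≡.sym u~v
    on-N y = refl
    on-N y' = ≡.sym u'~v'
    on-N (inn i) = refl

    on-N-edge : ∀ {m n} → NE₀ m n → ¬ (ι m ≡ dp × ι n ≡ dq) → colour (ι m) ≢ colour (ι n)
    on-N-edge {m} {n} e not-d same =
      parallel-proper (cG u) (cH u') e (λ (m≡p , n≡q) → not-d (cong ι m≡p , cong ι n≡q))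
        (trans (≡.sym (on-N m)) (trans same (on-N n)))

    proper : Proper (W ─ (dp , dq)) colour
    proper (gE e , _) = okG e
    proper (hE e , _) = okH e
    proper (nE m n (inj₁ e) refl refl , not-d) = on-N-edge e (not-d ∘ inj₁)
    proper (nE m n (inj₂ e) refl refl , not-d) = ≢-sym (on-N-edge e λ (n≡p , m≡q) → not-d (inj₂ (m≡q , n≡p)))

  -- Keep the interpretation of Σ_G on G − e, and send every
  -- other vertex to a minor of the operation g₀ of the critical edge e along a
  -- 6-tuple of colours: the constant tuple of its colour in a pinned colouring of
  -- H − f, or on N the colours given by `crossing` on each arc (tail j, head j).
  -- Adjacent tuples differ in every coordinate, and on x, x' the minors along
  -- the tails and heads are exactly f_u and f_v by the identities of e.
  implied-by-left : ∀ {a ℓ} → E G u v → Pinned H u' v' → Implies a ℓ G W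
  implied-by-left e₀ (cH , okH , u'~v') A C s =
    satisfies W F F∈ link
    where
    open Linking C
    f : V G → Op A 3
    f = proj₁ s
    g₀ : Op A 6
    g₀ = proj₁ (proj₂ s) u v e₀
    g₀∈ : _∈C C g₀
    g₀∈ = proj₁ (proj₂ (proj₂ (proj₂ s))) u v e₀

    label : NV → Fin 6 → Fin 3
    label m j = crossing (tail j) (head j) (cH u') m

    F : WV → Op A 3
    F (inj₁ w) = f w
    F (inj₂ (inj₁ w)) = minor g₀ (λ _ → cH w)
    F (inj₂ (inj₂ i)) = minor g₀ (label (inn i))

    F∈ : ∀ w → _∈C C (F w)
    F∈ (inj₁ w) = proj₁ (proj₂ (proj₂ s)) w
    F∈ (inj₂ (inj₁ w)) = minor-∈ C g₀∈ (λ _ → cH w)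
    F∈ (inj₂ (inj₂ i)) = minor-∈ C g₀∈ (label (inn i))

    on-N : ∀ m → F (ι m) ≈₃ minor g₀ (label m)
    on-N x = Linked.at-tails (linked G s e₀)
    on-N x' = Linked.at-heads (linked G s e₀)
    on-N y _ _ _ = refl
    on-N y' a b c = cong (λ k → minor g₀ (λ _ → k) (a ∷ b ∷ c ∷ [])) (≡.sym u'~v')
    on-N (inn i) _ _ _ = refl

    link : ∀ {w z} → WE w z → Linked (F w) (F z)
    link (gE e) = linked G s (proj₁ e)
    link (hE {w} {z} e) = minor-linked g₀∈ (λ _ → cH w) (λ _ → cH z) (λ _ → okH e)
    link (nE m n e refl refl) = Linked-resp (on-N m) (on-N n)
      (minor-linked g₀∈ (label m) (label n)
        (λ j → proper-both-ways (crossing-proper (cH u') (tail≢head j)) e))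

  exchange : W ⟶ Oplus.W H u' v' G u v
  exchange = h , h-edge
    where
    module W' = Oplus H u' v' G u v

    h : WV → W'.WV
    h (inj₁ w) = inj₂ (inj₁ w)
    h (inj₂ (inj₁ w)) = inj₁ w
    h (inj₂ (inj₂ i)) = W'.ι (mirror (inn i))

    h-ι : ∀ m → W'.ι (mirror m) ≡ h (ι m)
    h-ι x = refl
    h-ι x' = refl
    h-ι y = refl
    h-ι y' = refl
    h-ι (inn i) = refl

    h-edge : ∀ {a b} → WE a b → W'.WE (h a) (h b)
    h-edge (gE e) = W'.hE e
    h-edge (hE e) = W'.gE e
    h-edge (nE m n e refl refl) = W'.nE (mirror m) (mirror n) (mirror-edge e) (h-ι m) (h-ι n)

implied-by-right : ∀ {a ℓ} (G : Graph) (u v : V G) (H : Graph) (u' v' : V H) →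
                   E H u' v' → Pinned G u v → Implies a ℓ H ((G , u , v) ⊕ (H , u' , v'))
implied-by-right G u v H u' v' f₀ pin-G A C s =
  Linking.satisfies-pullback C (Oplus.W G u v H u' v') (Oplus.W H u' v' G u v)
    (Glued.exchange G u v H u' v')
    (Glued.implied-by-left H u' v' G u v f₀ pin-G A C s)

lemma4p1 : ∀ {a ℓ : Level} (G H : Graph) →
    Finite G → Finite H → Loopless G → Loopless H →
    ¬ ThreeColorable G → ¬ ThreeColorable H →
    (u v : V G) → Critical G u v →
    (u' v' : V H) → Critical H u' v' →
    ¬ ThreeColorable ((G , u , v) ⊕ (H , u' , v')) ×
    Critical ((G , u , v) ⊕ (H , u' , v')) (Oplus.dp G u v H u' v') (Oplus.dq G u v H u' v') ×
    Implies a ℓ G ((G , u , v) ⊕ (H , u' , v')) ×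
    Implies a ℓ H ((G , u , v) ⊕ (H , u' , v'))
lemma4p1 G H _ _ _ _ not-G not-H u v (e , G-e) u' v' (f , H-f) =
  not-colourable not-G not-H ,
  d-critical pin-G pin-H ,
  implied-by-left e pin-H ,
  implied-by-right G u v H u' v' f pin-G
  where
  open Glued G u v H u' v'
  pin-G : Pinned G u v
  pin-G = pinned G u v not-G G-e
  pin-H : Pinned H u' v'
  pin-H = pinned H u' v' not-H H-f
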